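{- For all bases $\mathscr B\subseteq\mathscr C$, every finite multiset of atoms $S$, every finite multiset $\Gamma$ of IMLL formulas and every IMLL formula $\phi$: if $\Gamma\Vdash^{S}_{\mathscr B}\phi$ then $\Gamma\Vdash^{S}_{\mathscr C}\phi$.
   Context: Fix a countably infinite set $\mathbb{A}$ of atoms. IMLL formulas: $\phi::=p\in\mathbb A\mid\phi\otimes\phi\mid\mathrm I\mid\phi\multimap\phi$. $\Gamma,\Delta$ denote finite multisets of formulas, $P,S,T,U,V$ finite multisets of atoms, "$\Gamma,\Delta$" multiset union, $\varnothing$ the empty multiset. An atomic rule is $(P_1\triangleright p_1,\dots,P_n\triangleright p_n)\Rightarrow p$ ($n\ge0$, $P_i$ finite multisets of atoms, $p_i,p$ atoms). A base is a (possibly infinite) set of atomic rules; $\mathscr C\supseteq\mathscr B$ means extension. Derivability $P\vdash_{\mathscr B}q$ is the least relation with: $[p]\vdash_{\mathscr B}p$ for every atom $p$; if $(P_1\triangleright p_1,\dots,P_n\triangleright p_n)\Rightarrow p\in\mathscr B$ and $S_i,P_i\vdash_{\mathscr B}p_i$ for $i=1,\dots,n$, then $S_1,\dots,S_n\vdash_{\mathscr B}p$. Support is defined inductively: $\Vdash^P_{\mathscr B}p$ iff $P\vdash_{\mathscr B}p$; $\Vdash^P_{\mathscr B}\phi\otimes\psi$ iff for every $\mathscr X\supseteq\mathscr B$, every $U$ and every atom $p$, if $\phi,\psi\Vdash^U_{\mathscr X}p$ then $\Vdash^{P,U}_{\mathscr X}p$; $\Vdash^P_{\mathscr B}\mathrm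 I$ iff for every $\mathscr X\supseteq\mathscr B$, $U$, atom $p$, if $\Vdash^U_{\mathscr X}p$ then $\Vdash^{P,U}_{\mathscr X}p$; $\Vdash^P_{\mathscr B}\phi\multimap\psi$ iff $\phi\Vdash^P_{\mathscr B}\psi$; for nonempty $\Gamma,\Delta$: $\Vdash^P_{\mathscr B}\Gamma,\Delta$ iff there are $U,V$ with $P=U,V$, $\Vdash^U_{\mathscr B}\Gamma$ and $\Vdash^V_{\mathscr B}\Delta$ (for a singleton multiset $[\phi]$ this is $\Vdash^P_{\mathscr B}\phi$); for nonempty $\Gamma$: $\Gamma\Vdash^P_{\mathscr B}\phi$ iff for every $\mathscr X\supseteq\mathscr B$ and every $U$, if $\Vdash^U_{\mathscr X}\Gamma$ then $\Vdash^{P,U}_{\mathscr X}\phi$; for empty $\Gamma$, $\Gamma\Vdash^P_{\mathscr B}\phi$ means $\Vdash^P_{\mathscr B}\phi$. -}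

module Defs where

open import Level using (Lift; lift; 0ℓ) renaming (suc to lsuc)
open import Data.Nat using (ℕ)
open import Data.List using (List; []; _∷_; _++_; [_])
open import Data.Product using (Σ; _×_; _,_; ∃-syntax)
open import Data.List.Relation.Binary.Permutation.Propositional using (_↭_)

Atom : Set
Atom = ℕ

-- Finite multisets are represented by lists, taken up to permutation (_↭_).
Multiset : Set → Set
Multiset A = List A

infixr 6 _⊗_
infixr 5 _⊸_
data Formula : Set where
  atom : Atom → Formula
  _⊗_  : Formula → Formula → Formula
  I    : Formula
  _⊸_  : Formula → Formula → Formula

record Rule : Set where
  constructor _⇒_
  field
    premises   : List (Multiset Atom × Atom)
    conclusion : Atom
open Rule public

Base : Set₁
Base = Rule → Set

_⊇_ : Base → Base → Set
C ⊇ B = ∀ r → B r → C r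

mutual
  data Derives (B : Base) : Multiset Atom → Atom → Set where
    ax   : ∀ {P p} → P ↭ [ p ] → Derives B P p
    rule : ∀ {r S P} → B r → Premises B (premises r) S → P ↭ S →
           Derives B P (conclusion r)

  data Premises (B : Base) : List (Multiset Atom × Atom) → Multiset Atom → Set where
    []  : Premises B [] []
    _∷_ : ∀ {Pᵢ pᵢ rs Sᵢ Rest} → Derives B (Sᵢ ++ Pᵢ) pᵢ →
          Premises B rs Rest → Premises B ((Pᵢ , pᵢ) ∷ rs) (Sᵢ ++ Rest)

Supp : Base → Multiset Atom → Formula → Set₁
Supp B P (atom p) = Lift (lsuc 0ℓ) (Derives B P p)
Supp B P (φ ⊗ ψ) =
  ∀ (X : Base) → X ⊇ B → ∀ (U : Multiset Atom) (p : Atom) →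
    -- φ, ψ ⊩^U_X p  (unfolded)
    (∀ (Y : Base) → Y ⊇ X → ∀ (W : Multiset Atom) →
       (Σ (Multiset Atom) λ W₁ → Σ (Multiset Atom) λ W₂ →
          (W ↭ W₁ ++ W₂) × Supp Y W₁ φ × Supp Y W₂ ψ) →
       Derives Y (U ++ W) p) →
    Derives X (P ++ U) p
Supp B P I =
  ∀ (X : Base) → X ⊇ B → ∀ (U : Multiset Atom) (p : Atom) →
    Derives X U p → Derives X (P ++ U) p
Supp B P (φ ⊸ ψ) =
  -- φ ⊩^P_ℬ ψ  (unfolded)
  ∀ (X : Base) → X ⊇ B → ∀ (U : Multiset Atom) →
    Supp X U φ → Supp X (P ++ U) ψ

-- Support of a multiset of formulas ⊩^P_ℬ Γ (meaningful for nonempty Γ).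
SuppCtx : Base → Multiset Atom → Multiset Formula → Set₁
SuppCtx B P []            = Lift (lsuc 0ℓ) (P ↭ [])
SuppCtx B P (φ ∷ [])      = Supp B P φ
SuppCtx B P (φ ∷ ψ ∷ Γ)   =
  Σ (Multiset Atom) λ U → Σ (Multiset Atom) λ V →
    (P ↭ U ++ V) × Supp B U φ × SuppCtx B V (ψ ∷ Γ)

Entails : Multiset Formula → Base → Multiset Atom → Formula → Set₁
Entails []      B P φ = Supp B P φ
Entails (γ ∷ Γ) B P φ =
  ∀ (X : Base) → X ⊇ B → ∀ (U : Multiset Atom) →
    SuppCtx X U (γ ∷ Γ) → Supp X (P ++ U) φ

module Submission where

open import Defs
open import Level using (lift)
open import Data.List using ([]; _∷_)

-- Derivability uses the rules of a base only positively; every other clause of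
-- support and entailment already quantifies over all extensions, so it is
-- monotone by transitivity of ⊇.

⊇-trans : ∀ {A B C : Base} → A ⊇ B → B ⊇ C → A ⊇ C
⊇-trans A⊇B B⊇C r r∈C = A⊇B r (B⊇C r r∈C)

mutual
  Derives-mono : ∀ {B C} → C ⊇ B → ∀ {P p} → Derives B P p → Derives C P p
  Derives-mono C⊇B (ax P↭p)                 = ax P↭p
  Derives-mono C⊇B (rule {r} r∈B prems P↭S) = rule (C⊇B r r∈B) (Premises-mono C⊇B prems) P↭S

  Premises-mono : ∀ {B C} → C ⊇ B → ∀ {rs S} → Premises B rs S → Premises C rs S
  Premises-mono C⊇B []          = []
  Premises-mono C⊇B (d ∷ prems) = Derives-mono C⊇B d ∷ Premises-mono C⊇B prems

Supp-mono : ∀ {B C} → C ⊇ B → ∀ {P} (φ : Formula) → Supp B P φ → Supp C P φ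
Supp-mono C⊇B (atom p) (lift d) = lift (Derives-mono C⊇B d)
Supp-mono C⊇B (φ ⊗ ψ)  s X X⊇C  = s X (⊇-trans X⊇C C⊇B)
Supp-mono C⊇B I        s X X⊇C  = s X (⊇-trans X⊇C C⊇B)
Supp-mono C⊇B (φ ⊸ ψ)  s X X⊇C  = s X (⊇-trans X⊇C C⊇B)

proposition1 : (B C : Base) → C ⊇ B → (S : Multiset Atom) (Γ : Multiset Formula) (φ : Formula) →
    Entails Γ B S φ → Entails Γ C S φ
proposition1 B C C⊇B S []      φ e       = Supp-mono C⊇B φ e
proposition1 B C C⊇B S (γ ∷ Γ) φ e X X⊇C = e X (⊇-trans X⊇C C⊇B)
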